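{- Every permutation in $\mathcal B_n$ has all its cycles of even length; hence $\mathcal B_n=\emptyset$ when $n$ is odd. When $n$ is even, the map $\sigma\mapsto\hat\sigma$ restricts to a bijection from $\mathcal B_n$ onto $\mathcal T_n$.
   Context: $[n]=\{1,\dots,n\}$, $\mathfrak S_n$ the symmetric group on $[n]$, $n\ge1$. $\mathcal B_n$ (biexceeded permutations) is the set of $\sigma\in\mathfrak S_n$ such that for every $j\in[n]$, either ($j<\sigma(j)$ and $j<\sigma^{ -1}(j)$) or ($j>\sigma(j)$ and $j>\sigma^{ -1}(j)$). $\mathcal T_n$ (alternating permutations) is the set of $\sigma\in\mathfrak S_n$ such that $\sigma(2j)<\sigma(2j-1)$ and $\sigma(2j)<\sigma(2j+1)$ for every integer $j$ with $2\le 2j\le n-1$, and, when $n$ is even, also $\sigma(n)<\sigma(n-1)$. The map $\sigma\mapsto\hat\sigma$: for $k\in[n]$ let $\bar k$ be the maximum of the $\sigma$-orbit of $k$, $q_k=\min\{p\ge0:\sigma^p(k)=\bar k\}$, $\Pi_\sigma(k)=(\bar k,q_k)$; $\hat\sigma$ is the unique permutation with $\Pi_\sigma(\hat\sigma(1)),\dots,\Pi_\sigma(\hat\sigma(n))$ lexicographically increasing. -}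

module Defs where

open import Data.Nat using (ℕ; zero; suc; _+_; _*_; _∸_; _<_; _≤_; _⊔_; _≟_; _<?_)
open import Data.Nat.Properties using ()
open import Data.Fin using (Fin; toℕ; fromℕ<)
open import Data.Fin.Permutation using (Permutation′; _⟨$⟩ʳ_; _⟨$⟩ˡ_)
open import Data.Product using (Σ; _×_; _,_; proj₁; proj₂)
open import Data.Sum using (_⊎_)
open import Relation.Binary.PropositionalEquality using (_≡_)
open import Relation.Nullary using (yes; no; ¬_)
open import Function using (_∘_)

-- Permutations of [n] are modelled as permutations of Fin n
-- (element i of Fin n stands for i+1 ∈ [n]; shifting by one preserves order).

_^[_]_ : ∀ {n} → Permutation′ n → ℕ → Fin n → Fin n
σ ^[ zero ] k = k
σ ^[ suc p ] k = σ ⟨$⟩ʳ (σ ^[ p ] k)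

Even : ℕ → Set
Even n = Σ ℕ (λ m → n ≡ m + m)

IsBiexceeded : ∀ {n} → Permutation′ n → Set
IsBiexceeded {n} σ = ∀ (j : Fin n) →
  (toℕ j < toℕ (σ ⟨$⟩ʳ j) × toℕ j < toℕ (σ ⟨$⟩ˡ j))
  ⊎ (toℕ (σ ⟨$⟩ʳ j) < toℕ j × toℕ (σ ⟨$⟩ˡ j) < toℕ j)

-- 1-indexed value σ(k) (as a 0-based ℕ) for k ∈ [n]; junk value 0 outside [n]
val : ∀ {n} → Permutation′ n → ℕ → ℕ
val {n} σ zero = 0
val {n} σ (suc k) with k <? n
... | yes k<n = toℕ (σ ⟨$⟩ʳ fromℕ< k<n)
... | no _ = 0

-- Alternating permutations (indices as in the paper, 1-based)
IsAlternating : ∀ {n} → Permutation′ n → Set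
IsAlternating {n} σ =
  (∀ (j : ℕ) → 2 ≤ 2 * j → 2 * j ≤ n ∸ 1 →
     val σ (2 * j) < val σ (2 * j ∸ 1) × val σ (2 * j) < val σ (2 * j + 1))
  × (Even n → val σ n < val σ (n ∸ 1))

IsCycleLength : ∀ {n} → Permutation′ n → Fin n → ℕ → Set
IsCycleLength σ k p =
  0 < p × (σ ^[ p ] k ≡ k) × (∀ q → 0 < q → q < p → ¬ (σ ^[ q ] k ≡ k))

-- maximum of the orbit of k: max of toℕ (σ^p k) for p < n
-- (the orbit of k is exactly {σ^p k | p < n}, since it has at most n elements)
orbitMaxUpTo : ∀ {n} → Permutation′ n → Fin n → ℕ → ℕ
orbitMaxUpTo σ k zero = 0
orbitMaxUpTo σ k (suc m) = orbitMaxUpTo σ k m ⊔ toℕ (σ ^[ m ] k)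

kbar : ∀ {n} → Permutation′ n → Fin n → ℕ
kbar {n} σ k = orbitMaxUpTo σ k n

-- least p < bound with toℕ (σ^p k) = target (returns bound if none)
leastHit : ∀ {n} → Permutation′ n → Fin n → ℕ → ℕ → ℕ
leastHit σ k target zero = zero
leastHit σ k target (suc m) with leastHit σ k target m
... | r with r <? m
...   | yes _ = r
...   | no _ with toℕ (σ ^[ m ] k) ≟ target
...     | yes _ = m
...     | no _ = suc m

qk : ∀ {n} → Permutation′ n → Fin n → ℕ
qk {n} σ k = leastHit σ k (kbar σ k) n

Π : ∀ {n} → Permutation′ n → Fin n → ℕ × ℕ
Π σ k = kbar σ k , qk σ k

_<lex_ : ℕ × ℕ → ℕ × ℕ → Set
(a , b) <lex (c , d) = a < c ⊎ (a ≡ c × b < d)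

IsHat : ∀ {n} → Permutation′ n → Permutation′ n → Set
IsHat {n} σ τ = ∀ (i j : Fin n) → toℕ i < toℕ j → Π σ (τ ⟨$⟩ʳ i) <lex Π σ (τ ⟨$⟩ʳ j)

{-# OPTIONS --safe #-}
-- A biexceeded σ consists of peaks (σ x < x > σ⁻¹ x) and valleys (σ x > x < σ⁻¹ x), and σ maps
-- peaks to valleys and valleys to peaks, so all its cycles have even length.
--
-- σ̂ lists the cycles of σ by increasing maximum, each read from its maximum along σ⁻¹
-- (q_k is the distance from k to that maximum).  So two consecutive entries of σ̂ either satisfy
-- σ (σ̂ (i+1)) = σ̂ i or the second one opens a new cycle, and the openings are exactly the
-- left-to-right maxima of σ̂.  Hence σ is determined by σ̂: it moves every entry one position back,
-- except that a left-to-right maximum goes to the last entry of its block; and this recipe, applied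
-- to any τ, yields a permutation whose hat is τ.  For biexceeded σ the peaks are the x with q_x
-- even, and q has the parity of the position in σ̂, so σ̂ has its valleys exactly at the odd
-- (0-based) positions, i.e. it is alternating, and its last entry, which closes an even cycle,
-- sits at an odd position, so n is even.  Conversely the recipe turns an alternating τ into a
-- biexceeded permutation.
module Submission where

open import Defs
open import Data.Empty using (⊥; ⊥-elim)
open import Data.Fin using (Fin; toℕ; fromℕ<; punchOut)
open import Data.Fin.Permutation using (Permutation′; _⟨$⟩ʳ_; _⟨$⟩ˡ_; inverseˡ; inverseʳ; permutation; flip; _≈_; _∘ₚ_)
open import Data.Fin.Properties
  using (toℕ-injective; toℕ<n; toℕ-fromℕ<; fromℕ<-toℕ; fromℕ<-injective; pigeonhole; any?; punchOut-injective; injective⇒≤)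
  renaming (_≟_ to _≟ᶠ_)
open import Data.Fin.Subset using (Subset; _∈_; _∉_; ∣_∣)
open import Data.Fin.Subset.Properties using (∈⊤; ∣⊤∣≡n; p⊂q⇒∣p∣<∣q∣)
open import Data.Nat using (ℕ; zero; suc; pred; _+_; _*_; _∸_; _<_; _≤_; _⊔_; _≟_; _<?_; z≤n; s≤s; s≤s⁻¹; parity)
open import Data.Nat.Properties
open import Data.Parity.Base as ℙ using (Parity; 0ℙ; 1ℙ; _⁻¹)
import Data.Parity.Properties as ℙ
open import Data.Product using (Σ; ∃; _×_; _,_; proj₁; proj₂)
open import Data.Product.Relation.Binary.Lex.Strict using (×-isStrictTotalOrder)
open import Data.Product.Relation.Binary.Pointwise.NonDependent using (Pointwise)
open import Data.Sum using (_⊎_; inj₁; inj₂)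
open import Data.Vec using (tabulate)
open import Data.Vec.Properties using (lookup∘tabulate; lookup⇒[]=; []=⇒lookup)
open import Function using (_∘_)
open import Function.Bundles using (Injection)
open import Function.Properties.Inverse using (↔⇒↣)
open import Relation.Binary.Definitions using (tri<; tri≈; tri>)
open import Relation.Binary.PropositionalEquality
open import Relation.Binary.Structures using (IsStrictTotalOrder)
open import Relation.Nullary using (yes; no; ¬_; Dec)
open import Relation.Nullary.Decidable using (does; dec-true; map′)
open import Relation.Nullary.Negation using (contradiction)

m<o∸n⇒n<o∸m : ∀ {m n o} → n ≤ o → m < o ∸ n → n < o ∸ m
m<o∸n⇒n<o∸m {m} {n} {o} n≤o m<o-n =
  m+n≤o⇒m≤o∸n (suc n) (subst (_≤ o) (cong suc (+-comm m n)) (m≤o∸n⇒m+n≤o (suc m) n≤o m<o-n))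

parity-suc : ∀ n → parity (suc n) ≡ parity n ⁻¹
parity-suc n = ℙ.+-homo-+ 1 n

Even⇒parity≡0ℙ : ∀ {n} → Even n → parity n ≡ 0ℙ
Even⇒parity≡0ℙ (m , refl) = trans (ℙ.+-homo-+ m m) (ℙ.p+p≡0ℙ (parity m))

parity≡0ℙ⇒Even : ∀ n → parity n ≡ 0ℙ → Even n
parity≡0ℙ⇒Even zero          _ = zero , refl
parity≡0ℙ⇒Even (suc (suc n)) e with parity≡0ℙ⇒Even n e
... | m , refl = suc m , cong suc (sym (+-suc m m))

parity≡1ℙ⇒odd : ∀ k → parity k ≡ 1ℙ → ∃ λ m → k ≡ suc (m + m)
parity≡1ℙ⇒odd (suc k) e with parity≡0ℙ⇒Even k (ℙ.⁻¹-injective (trans (sym (parity-suc k)) e))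
... | m , refl = m , refl

parity-odd : ∀ m → parity (suc (m + m)) ≡ 1ℙ
parity-odd m = trans (parity-suc (m + m)) (cong _⁻¹ (Even⇒parity≡0ℙ (m , refl)))

2*suc : ∀ m → 2 * suc m ≡ suc (suc (m + m))
2*suc m = cong suc (trans (cong (m +_) (cong suc (+-identityʳ m))) (+-suc m m))

⟨$⟩ʳ-injective : ∀ {n} (π : Permutation′ n) {x y} → π ⟨$⟩ʳ x ≡ π ⟨$⟩ʳ y → x ≡ y
⟨$⟩ʳ-injective π = Injection.injective (↔⇒↣ π)

_⋖_ : ∀ {n} → Fin n → Fin n → Set
i ⋖ j = toℕ j ≡ suc (toℕ i)

⋖⇒< : ∀ {n} {i j : Fin n} → i ⋖ j → toℕ i < toℕ j
⋖⇒< i⋖j = ≤-reflexive (sym i⋖j)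

predecessor : ∀ {n} (j : Fin n) {k} → toℕ j ≡ suc k → ∃ λ i → i ⋖ j × toℕ i ≡ k
predecessor {n} j {k} j≡1+k = fromℕ< k<n , trans j≡1+k (cong suc (sym (toℕ-fromℕ< k<n))) , toℕ-fromℕ< k<n
  where
  k<n : k < n
  k<n = <-trans (≤-reflexive (sym j≡1+k)) (toℕ<n j)

injective⇒surjective : ∀ {n} (f : Fin n → Fin n) → (∀ {x y} → f x ≡ f y → x ≡ y) → ∀ y → ∃ λ x → f x ≡ y
injective⇒surjective {suc m} f f-injective y with any? (λ x → f x ≟ᶠ y)
... | yes found  = found
... | no  ¬found = contradiction (injective⇒≤ {f = f-y} f-y-injective) (<-irrefl refl)
  where
  f-y : Fin (suc m) → Fin m
  f-y x = punchOut {i = y} {j = f x} (λ y≡fx → ¬found (x , sym y≡fx))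
  f-y-injective : ∀ {x x′} → f-y x ≡ f-y x′ → x ≡ x′
  f-y-injective {x} {x′} e =
    f-injective (punchOut-injective (λ y≡fx → ¬found (x , sym y≡fx)) (λ y≡fx′ → ¬found (x′ , sym y≡fx′)) e)

injective⇒permutation : ∀ {n} (f : Fin n → Fin n) → (∀ {x y} → f x ≡ f y → x ≡ y) → Permutation′ n
injective⇒permutation f f-injective = permutation f (proj₁ ∘ surjective) (proj₂ ∘ surjective)
  (λ x → f-injective (proj₂ (surjective (f x))))
  where surjective = injective⇒surjective f f-injective

strictlyIncreasing⇒≤ : ∀ {n} (f : Fin n → Fin n) → (∀ {i j} → toℕ i < toℕ j → toℕ (f i) < toℕ (f j)) →
                       ∀ i → toℕ i ≤ toℕ (f i)
strictlyIncreasing⇒≤ f increasing i = go (toℕ i) i refl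
  where
  go : ∀ k i → toℕ i ≡ k → k ≤ toℕ (f i)
  go zero    _ _     = z≤n
  go (suc k) j j≡k+1 with i , i⋖j , i≡k ← predecessor j j≡k+1 =
    <-≤-trans (s≤s (go k i i≡k)) (increasing (⋖⇒< i⋖j))

<lex-isStrictTotalOrder : IsStrictTotalOrder (Pointwise _≡_ _≡_) _<lex_
<lex-isStrictTotalOrder = ×-isStrictTotalOrder <-isStrictTotalOrder <-isStrictTotalOrder

open IsStrictTotalOrder <lex-isStrictTotalOrder
  using () renaming (compare to <lex-compare; trans to <lex-trans; asym to <lex-asym; _<?_ to _<lex?_)

<lex-irrefl : ∀ {a} → ¬ a <lex a
<lex-irrefl = IsStrictTotalOrder.irrefl <lex-isStrictTotalOrder (refl , refl)

<lex-between-suc : ∀ M q P → (M , q) <lex P → P <lex (M , suc q) → ⊥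
<lex-between-suc M q P (inj₁ M<P)        (inj₁ P<M)        = <-asym M<P P<M
<lex-between-suc M q P (inj₁ M<P)        (inj₂ (refl , _)) = <-irrefl refl M<P
<lex-between-suc M q P (inj₂ (refl , _)) (inj₁ P<M)        = <-irrefl refl P<M
<lex-between-suc M q P (inj₂ (_ , q<P))  (inj₂ (_ , P<q+1)) = <-irrefl refl (≤-trans (s≤s q<P) P<q+1)

<lex-0⇒< : ∀ {a b c} → (a , b) <lex (c , 0) → a < c
<lex-0⇒< (inj₁ a<c) = a<c

<lex⇒≤ : ∀ {a b c d} → (a , b) <lex (c , d) → a ≤ c
<lex⇒≤ (inj₁ a<c)        = <⇒≤ a<c
<lex⇒≤ (inj₂ (refl , _)) = ≤-refl

module Iterate {n} (σ : Permutation′ n) where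

  ^-suc : ∀ p x → σ ^[ suc p ] x ≡ σ ^[ p ] (σ ⟨$⟩ʳ x)
  ^-suc zero    x = refl
  ^-suc (suc p) x = cong (σ ⟨$⟩ʳ_) (^-suc p x)

  ^-+ : ∀ p q x → σ ^[ p + q ] x ≡ σ ^[ p ] (σ ^[ q ] x)
  ^-+ zero    q x = refl
  ^-+ (suc p) q x = cong (σ ⟨$⟩ʳ_) (^-+ p q x)

  ^-injective : ∀ p {x y} → σ ^[ p ] x ≡ σ ^[ p ] y → x ≡ y
  ^-injective zero    e = e
  ^-injective (suc p) e = ^-injective p (⟨$⟩ʳ-injective σ e)

  period : ∀ x → ∃ λ d → 0 < d × d ≤ n × σ ^[ d ] x ≡ x
  period x with i , j , i<j , e ← pigeonhole ≤-refl (λ (i : Fin (suc n)) → σ ^[ toℕ i ] x) =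
    toℕ j ∸ toℕ i , m<n⇒0<n∸m i<j , ≤-trans (m∸n≤m (toℕ j) (toℕ i)) (s≤s⁻¹ (toℕ<n j)) ,
    ^-injective (toℕ i) (begin
      σ ^[ toℕ i ] (σ ^[ toℕ j ∸ toℕ i ] x) ≡⟨ ^-+ (toℕ i) (toℕ j ∸ toℕ i) x ⟨
      σ ^[ toℕ i + (toℕ j ∸ toℕ i) ] x      ≡⟨ cong (λ k → σ ^[ k ] x) (m+[n∸m]≡n (<⇒≤ i<j)) ⟩
      σ ^[ toℕ j ] x                        ≡⟨ e ⟨
      σ ^[ toℕ i ] x                        ∎)
    where open ≡-Reasoning

  ^-below-n : ∀ x p → ∃ λ p′ → p′ < n × σ ^[ p ] x ≡ σ ^[ p′ ] x
  ^-below-n x p with d , 0<d , d≤n , σᵈx≡x ← period x =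
    let p′ , p′<d , e = below-d p in p′ , ≤-trans p′<d d≤n , e
    where
    below-d : ∀ p → ∃ λ p′ → p′ < d × σ ^[ p ] x ≡ σ ^[ p′ ] x
    below-d zero = 0 , 0<d , refl
    below-d (suc p) with p′ , p′<d , e ← below-d p | suc p′ <? d
    ... | yes p′+1<d = suc p′ , p′+1<d , cong (σ ⟨$⟩ʳ_) e
    ... | no  p′+1≮d = 0 , 0<d , trans (cong (σ ⟨$⟩ʳ_) e)
                           (trans (cong (λ k → σ ^[ k ] x) (≤-antisym p′<d (≮⇒≥ p′+1≮d))) σᵈx≡x)

module Orbit {n} (σ : Permutation′ n) where
  open Iterate σ

  orbitMaxUpTo-upper : ∀ x {m p} → p < m → toℕ (σ ^[ p ] x) ≤ orbitMaxUpTo σ x m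
  orbitMaxUpTo-upper x {suc m} p<1+m with m≤n⇒m<n∨m≡n (s≤s⁻¹ p<1+m)
  ... | inj₁ p<m  = ≤-trans (orbitMaxUpTo-upper x p<m) (m≤m⊔n _ _)
  ... | inj₂ refl = m≤n⊔m (orbitMaxUpTo σ x m) _

  orbitMaxUpTo-attained : ∀ x m → 0 < m → ∃ λ p → p < m × toℕ (σ ^[ p ] x) ≡ orbitMaxUpTo σ x m
  orbitMaxUpTo-attained x (suc zero)    _ = 0 , s≤s z≤n , refl
  orbitMaxUpTo-attained x (suc (suc m)) _
    with orbitMaxUpTo-attained x (suc m) (s≤s z≤n) | ⊔-sel (orbitMaxUpTo σ x (suc m)) (toℕ (σ ^[ suc m ] x))
  ... | p , p<1+m , h | inj₁ e = p , m<n⇒m<1+n p<1+m , trans h (sym e)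
  ... | _             | inj₂ e = suc m , ≤-refl , sym e

  kbar-upper : ∀ x p → toℕ (σ ^[ p ] x) ≤ kbar σ x
  kbar-upper x p with p′ , p′<n , e ← ^-below-n x p =
    subst (λ y → toℕ y ≤ kbar σ x) (sym e) (orbitMaxUpTo-upper x p′<n)

  kbar-attained : ∀ x → ∃ λ p → p < n × toℕ (σ ^[ p ] x) ≡ kbar σ x
  kbar-attained x = orbitMaxUpTo-attained x n (≤-<-trans z≤n (toℕ<n x))

  ≤-kbar : ∀ x → toℕ x ≤ kbar σ x
  ≤-kbar x = kbar-upper x 0

  kbar-unique : ∀ x K → (∀ p → toℕ (σ ^[ p ] x) ≤ K) → (∃ λ p → toℕ (σ ^[ p ] x) ≡ K) → kbar σ x ≡ K
  kbar-unique x K upper (p , hit) with q , _ , hit′ ← kbar-attained x =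
    ≤-antisym (subst (_≤ K) hit′ (upper q)) (subst (_≤ kbar σ x) hit (kbar-upper x p))

  kbar-σ : ∀ x → kbar σ (σ ⟨$⟩ʳ x) ≡ kbar σ x
  kbar-σ x = kbar-unique (σ ⟨$⟩ʳ x) (kbar σ x) upper attained
    where
    upper : ∀ p → toℕ (σ ^[ p ] (σ ⟨$⟩ʳ x)) ≤ kbar σ x
    upper p = subst (λ y → toℕ y ≤ kbar σ x) (^-suc p x) (kbar-upper x (suc p))
    attained : ∃ λ p → toℕ (σ ^[ p ] (σ ⟨$⟩ʳ x)) ≡ kbar σ x
    attained with p , _ , hit ← kbar-attained x | suc d , _ , _ , σᵈx≡x ← period x =
      p + d , trans (cong toℕ around) hit
      where
      open ≡-Reasoning
      around : σ ^[ p + d ] (σ ⟨$⟩ʳ x) ≡ σ ^[ p ] x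
      around = begin
        σ ^[ p + d ] (σ ⟨$⟩ʳ x)    ≡⟨ ^-suc (p + d) x ⟨
        σ ^[ suc (p + d) ] x       ≡⟨ cong (λ k → σ ^[ k ] x) (+-suc p d) ⟨
        σ ^[ p + suc d ] x         ≡⟨ ^-+ p (suc d) x ⟩
        σ ^[ p ] (σ ^[ suc d ] x)  ≡⟨ cong (σ ^[ p ]_) σᵈx≡x ⟩
        σ ^[ p ] x                 ∎

  kbar-^ : ∀ p x → kbar σ (σ ^[ p ] x) ≡ kbar σ x
  kbar-^ zero    x = refl
  kbar-^ (suc p) x = trans (kbar-σ (σ ^[ p ] x)) (kbar-^ p x)

  kbar-σ⁻¹ : ∀ x → kbar σ (σ ⟨$⟩ˡ x) ≡ kbar σ x
  kbar-σ⁻¹ x = trans (sym (kbar-σ (σ ⟨$⟩ˡ x))) (cong (kbar σ) (inverseʳ σ))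

  module _ (x : Fin n) (K : ℕ) where

    Hits : ℕ → Set
    Hits p = toℕ (σ ^[ p ] x) ≡ K

    data LeastHitView (m r : ℕ) : Set where
      hit  : r < m → Hits r → (∀ p → p < r → ¬ Hits p) → LeastHitView m r
      miss : r ≡ m → (∀ p → p < m → ¬ Hits p) → LeastHitView m r

    leastHit-view : ∀ m → LeastHitView m (leastHit σ x K m)
    leastHit-view zero = miss refl λ _ ()
    leastHit-view (suc m) with leastHit σ x K m | leastHit-view m
    ... | r | view with r <? m
    ...   | yes r<m = earlier view
      where
      earlier : LeastHitView m r → LeastHitView (suc m) r
      earlier (hit r<m h minimal) = hit (m<n⇒m<1+n r<m) h minimal
      earlier (miss r≡m _)        = contradiction r≡m (<⇒≢ r<m)
    ...   | no r≮m with toℕ (σ ^[ m ] x) ≟ K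
    ...     | yes h = hit ≤-refl h (none-below view)
      where
      none-below : LeastHitView m r → ∀ p → p < m → ¬ Hits p
      none-below (hit r<m _ _) = contradiction r<m r≮m
      none-below (miss _ none) = none
    ...     | no ¬h = miss refl (none-upto view)
      where
      none-upto : LeastHitView m r → ∀ p → p < suc m → ¬ Hits p
      none-upto (hit r<m _ _) = contradiction r<m r≮m
      none-upto (miss _ none) p p<1+m with m≤n⇒m<n∨m≡n (s≤s⁻¹ p<1+m)
      ... | inj₁ p<m  = none p p<m
      ... | inj₂ refl = ¬h

  qk-hits-and-minimal : ∀ x → Hits x (kbar σ x) (qk σ x) × (∀ p → p < qk σ x → ¬ Hits x (kbar σ x) p)
  qk-hits-and-minimal x with leastHit-view x (kbar σ x) n
  ... | hit _ h minimal = h , minimal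
  ... | miss _ none with p , p<n , h ← kbar-attained x = contradiction h (none p p<n)

  qk-hits : ∀ x → toℕ (σ ^[ qk σ x ] x) ≡ kbar σ x
  qk-hits x = proj₁ (qk-hits-and-minimal x)

  qk-minimal : ∀ x p → p < qk σ x → ¬ toℕ (σ ^[ p ] x) ≡ kbar σ x
  qk-minimal x = proj₂ (qk-hits-and-minimal x)

  qk-unique : ∀ x Q → toℕ (σ ^[ Q ] x) ≡ kbar σ x → (∀ p → p < Q → ¬ toℕ (σ ^[ p ] x) ≡ kbar σ x) → qk σ x ≡ Q
  qk-unique x Q h minimal with <-cmp (qk σ x) Q
  ... | tri< lt _ _ = contradiction (qk-hits x) (minimal _ lt)
  ... | tri≈ _ e _  = e
  ... | tri> _ _ gt = contradiction h (qk-minimal x Q gt)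

  qk≡0⇒max : ∀ x → qk σ x ≡ 0 → toℕ x ≡ kbar σ x
  qk≡0⇒max x e = subst (λ q → toℕ (σ ^[ q ] x) ≡ kbar σ x) e (qk-hits x)

  max⇒qk≡0 : ∀ x → toℕ x ≡ kbar σ x → qk σ x ≡ 0
  max⇒qk≡0 x e = qk-unique x 0 e (λ _ ())

  qk-σ : ∀ x {r} → qk σ x ≡ suc r → qk σ (σ ⟨$⟩ʳ x) ≡ r
  qk-σ x {r} e = qk-unique (σ ⟨$⟩ʳ x) r h minimal
    where
    h : toℕ (σ ^[ r ] (σ ⟨$⟩ʳ x)) ≡ kbar σ (σ ⟨$⟩ʳ x)
    h = trans (cong toℕ (sym (^-suc r x)))
          (trans (subst (λ q → toℕ (σ ^[ q ] x) ≡ kbar σ x) e (qk-hits x)) (sym (kbar-σ x)))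
    minimal : ∀ p → p < r → ¬ toℕ (σ ^[ p ] (σ ⟨$⟩ʳ x)) ≡ kbar σ (σ ⟨$⟩ʳ x)
    minimal p p<r h′ = qk-minimal x (suc p) (subst (suc p <_) (sym e) (s≤s p<r))
      (trans (cong toℕ (^-suc p x)) (trans h′ (kbar-σ x)))

  qk-σ⁻¹ : ∀ x {r} → qk σ (σ ⟨$⟩ˡ x) ≡ suc r → qk σ x ≡ r
  qk-σ⁻¹ x e = trans (cong (qk σ) (sym (inverseʳ σ))) (qk-σ (σ ⟨$⟩ˡ x) e)

  qk-^ : ∀ d x → d ≤ qk σ x → qk σ (σ ^[ d ] x) ≡ qk σ x ∸ d
  qk-^ zero    x _   = refl
  qk-^ (suc d) x d<q = qk-σ (σ ^[ d ] x)
    (trans (qk-^ d x (<⇒≤ d<q)) (+-∸-assoc 1 d<q))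

  Π-injective : ∀ {x y} → Π σ x ≡ Π σ y → x ≡ y
  Π-injective {x} {y} e = ^-injective (qk σ x) (toℕ-injective (begin
    toℕ (σ ^[ qk σ x ] x) ≡⟨ qk-hits x ⟩
    kbar σ x              ≡⟨ cong proj₁ e ⟩
    kbar σ y              ≡⟨ qk-hits y ⟨
    toℕ (σ ^[ qk σ y ] y) ≡⟨ cong (λ q → toℕ (σ ^[ q ] y)) (cong proj₂ e) ⟨
    toℕ (σ ^[ qk σ x ] y) ∎))
    where open ≡-Reasoning

  Π-σ-<lex : ∀ x {r} → qk σ x ≡ suc r → Π σ (σ ⟨$⟩ʳ x) <lex Π σ x
  Π-σ-<lex x {r} e = inj₂ (kbar-σ x , subst₂ _<_ (sym (qk-σ x e)) (sym e) ≤-refl)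

  cycle-closes : ∀ x → qk σ (σ ⟨$⟩ˡ x) ≡ 0 → σ ^[ suc (qk σ x) ] (σ ⟨$⟩ˡ x) ≡ σ ⟨$⟩ˡ x
  cycle-closes x e = toℕ-injective (begin
    toℕ (σ ^[ suc (qk σ x) ] (σ ⟨$⟩ˡ x)) ≡⟨ cong toℕ (^-suc (qk σ x) (σ ⟨$⟩ˡ x)) ⟩
    toℕ (σ ^[ qk σ x ] (σ ⟨$⟩ʳ (σ ⟨$⟩ˡ x))) ≡⟨ cong (λ y → toℕ (σ ^[ qk σ x ] y)) (inverseʳ σ) ⟩
    toℕ (σ ^[ qk σ x ] x)                ≡⟨ qk-hits x ⟩
    kbar σ x                             ≡⟨ kbar-σ⁻¹ x ⟨
    kbar σ (σ ⟨$⟩ˡ x)                    ≡⟨ qk≡0⇒max (σ ⟨$⟩ˡ x) e ⟨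
    toℕ (σ ⟨$⟩ˡ x)                       ∎)
    where open ≡-Reasoning

  -- walking from z towards the maximum passes through σ⁻¹ x just before x
  qk-σ⁻¹≡suc : ∀ x z → kbar σ z ≡ kbar σ x → qk σ x < qk σ z → qk σ (σ ⟨$⟩ˡ x) ≡ suc (qk σ x)
  qk-σ⁻¹≡suc x z same-cycle farther = begin
    qk σ (σ ⟨$⟩ˡ x)                  ≡⟨ cong (qk σ) w≡σ⁻¹x ⟨
    qk σ w                           ≡⟨ qk-w ⟩
    suc (qk σ x)                     ∎
    where
    open ≡-Reasoning
    d = qk σ z ∸ suc (qk σ x)
    w = σ ^[ d ] z
    qk-w : qk σ w ≡ suc (qk σ x)
    qk-w = trans (qk-^ d z (m∸n≤m (qk σ z) (suc (qk σ x)))) (m∸[m∸n]≡n farther)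
    σw≡x : σ ⟨$⟩ʳ w ≡ x
    σw≡x = Π-injective (cong₂ _,_ (trans (kbar-σ w) (trans (kbar-^ d z) same-cycle)) (qk-σ w qk-w))
    w≡σ⁻¹x : w ≡ σ ⟨$⟩ˡ x
    w≡σ⁻¹x = trans (sym (inverseˡ σ)) (cong (σ ⟨$⟩ˡ_) σw≡x)

module Hat {n} (σ τ : Permutation′ n) (hat : IsHat σ τ) where
  open Iterate σ
  open Orbit σ

  T : Fin n → Fin n
  T i = τ ⟨$⟩ʳ i

  pos : Fin n → Fin n
  pos x = τ ⟨$⟩ˡ x

  hat-pos : ∀ {x y} → toℕ (pos x) < toℕ (pos y) → Π σ x <lex Π σ y
  hat-pos {x} {y} lt = subst₂ (λ u v → Π σ u <lex Π σ v) (inverseʳ τ) (inverseʳ τ) (hat _ _ lt)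

  pos-< : ∀ {x y} → Π σ x <lex Π σ y → toℕ (pos x) < toℕ (pos y)
  pos-< {x} {y} lt with <-cmp (toℕ (pos x)) (toℕ (pos y))
  ... | tri< p _ _ = p
  ... | tri≈ _ e _ = contradiction (subst (λ z → Π σ x <lex Π σ z) (sym x≡y) lt) <lex-irrefl
    where
    x≡y : x ≡ y
    x≡y = trans (sym (inverseʳ τ)) (trans (cong T (toℕ-injective e)) (inverseʳ τ))
  ... | tri> _ _ p = contradiction (hat-pos p) (<lex-asym lt)

  pos-T : ∀ i → pos (T i) ≡ i
  pos-T i = inverseˡ τ

  T-<lex⇒< : ∀ {i z} → Π σ (T i) <lex Π σ z → toℕ i < toℕ (pos z)
  T-<lex⇒< {i} {z} lt = subst (λ k → toℕ k < toℕ (pos z)) (pos-T i) (pos-< lt)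

  <lex-T⇒< : ∀ {z j} → Π σ z <lex Π σ (T j) → toℕ (pos z) < toℕ j
  <lex-T⇒< {z} {j} lt = subst (λ k → toℕ (pos z) < toℕ k) (pos-T j) (pos-< lt)

  nothing-between : ∀ {i j} → i ⋖ j → ∀ z → Π σ (T i) <lex Π σ z → Π σ z <lex Π σ (T j) → ⊥
  nothing-between {i} {j} i⋖j z after before = <-irrefl refl (begin-strict
    suc (toℕ i)     ≤⟨ T-<lex⇒< after ⟩
    toℕ (pos z)     <⟨ <lex-T⇒< before ⟩
    toℕ j           ≡⟨ i⋖j ⟩
    suc (toℕ i)     ∎)
    where open ≤-Reasoning

  next-or-later : ∀ {i j} → i ⋖ j → ∀ z → Π σ (T i) <lex Π σ z → T j ≡ z ⊎ Π σ (T j) <lex Π σ z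
  next-or-later {i} {j} i⋖j z after
    with m≤n⇒m<n∨m≡n (subst (_≤ toℕ (pos z)) (sym i⋖j) (T-<lex⇒< after))
  ... | inj₁ j<pz = inj₂ (hat-pos (subst (λ k → toℕ k < toℕ (pos z)) (sym (pos-T j)) j<pz))
  ... | inj₂ j≡pz = inj₁ (trans (cong T (toℕ-injective j≡pz)) (inverseʳ τ))

  module _ {i j : Fin n} (i⋖j : i ⋖ j) where

    continues-cycle : ∀ {r} → qk σ (σ ⟨$⟩ˡ T i) ≡ suc r → T j ≡ σ ⟨$⟩ˡ T i
    continues-cycle e with next-or-later i⋖j (σ ⟨$⟩ˡ T i) (inj₂ (sym (kbar-σ⁻¹ (T i)) , ≤-reflexive (sym q+1)))
      where q+1 = trans e (cong suc (sym (qk-σ⁻¹ (T i) e)))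
    ... | inj₁ Tj≡σ⁻¹x = Tj≡σ⁻¹x
    ... | inj₂ Tj<σ⁻¹x = ⊥-elim (<lex-between-suc (kbar σ (T i)) (qk σ (T i)) (Π σ (T j))
                           (hat i j (⋖⇒< i⋖j)) (subst (Π σ (T j) <lex_) Πσ⁻¹x Tj<σ⁻¹x))
      where
      Πσ⁻¹x : Π σ (σ ⟨$⟩ˡ T i) ≡ (kbar σ (T i) , suc (qk σ (T i)))
      Πσ⁻¹x = cong₂ _,_ (kbar-σ⁻¹ (T i)) (trans e (cong suc (sym (qk-σ⁻¹ (T i) e))))

    kbar-increases : qk σ (σ ⟨$⟩ˡ T i) ≡ 0 → kbar σ (T i) < kbar σ (T j)
    kbar-increases closes with hat i j (⋖⇒< i⋖j)
    ... | inj₁ lt = lt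
    ... | inj₂ (same , farther) = contradiction (trans (sym closes) (qk-σ⁻¹≡suc (T i) (T j) (sym same) farther)) λ ()

    starts-cycle : qk σ (σ ⟨$⟩ˡ T i) ≡ 0 → qk σ (T j) ≡ 0
    starts-cycle closes with qk σ (T j) in e
    ... | zero  = refl
    ... | suc r = ⊥-elim (nothing-between i⋖j (σ ⟨$⟩ʳ T j)
                    (inj₁ (subst (kbar σ (T i) <_) (sym (kbar-σ (T j))) (kbar-increases closes))) (Π-σ-<lex (T j) e))

  data Adjacent (x y : Fin n) : Set where
    sameCycle : σ ⟨$⟩ʳ y ≡ x → qk σ y ≡ suc (qk σ x) → Adjacent x y
    newCycle  : qk σ (σ ⟨$⟩ˡ x) ≡ 0 → qk σ y ≡ 0 → kbar σ x < kbar σ y → Adjacent x y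

  adjacent : ∀ {i j} → i ⋖ j → Adjacent (T i) (T j)
  adjacent {i} {j} i⋖j with qk σ (σ ⟨$⟩ˡ T i) in e
  ... | zero  = newCycle e (starts-cycle i⋖j e) (kbar-increases i⋖j e)
  ... | suc r = sameCycle (trans (cong (σ ⟨$⟩ʳ_) Tj≡σ⁻¹x) (inverseʳ σ))
                  (trans (cong (qk σ) Tj≡σ⁻¹x) (trans e (cong suc (sym (qk-σ⁻¹ (T i) e)))))
    where Tj≡σ⁻¹x = continues-cycle i⋖j e

  first-qk≡0 : ∀ i → toℕ i ≡ 0 → qk σ (T i) ≡ 0
  first-qk≡0 i i≡0 with qk σ (T i) in e
  ... | zero  = refl
  ... | suc r = ⊥-elim (n≮0 (subst (toℕ (pos (σ ⟨$⟩ʳ T i)) <_) i≡0 (<lex-T⇒< (Π-σ-<lex (T i) e))))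

  last-closes : ∀ i → suc (toℕ i) ≡ n → qk σ (σ ⟨$⟩ˡ T i) ≡ 0
  last-closes i i+1≡n with qk σ (σ ⟨$⟩ˡ T i) in e
  ... | zero  = refl
  ... | suc r = contradiction (toℕ<n (pos y)) (≤⇒≯ (subst (_≤ toℕ (pos y)) i+1≡n i<pos-y))
    where
    y = σ ⟨$⟩ˡ T i
    i<pos-y : toℕ i < toℕ (pos y)
    i<pos-y = T-<lex⇒< (subst (λ u → Π σ u <lex Π σ y) (inverseʳ σ) (Π-σ-<lex y e))

  IsLRMaxAt : Fin n → Set
  IsLRMaxAt j = ∀ i → toℕ i < toℕ j → toℕ (T i) < toℕ (T j)

  LRMax⇒qk≡0 : ∀ j → IsLRMaxAt j → qk σ (T j) ≡ 0
  LRMax⇒qk≡0 j lr with qk σ (T j) in e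
  ... | zero  = refl
  ... | suc r = ⊥-elim (<-irrefl refl (≤-<-trans Tj≤m (subst (λ u → toℕ u < toℕ (T j)) (inverseʳ τ) (lr (pos m) pos-m<j))))
    where
    m = σ ^[ suc r ] (T j)
    m-max : toℕ m ≡ kbar σ (T j)
    m-max = subst (λ q → toℕ (σ ^[ q ] (T j)) ≡ kbar σ (T j)) e (qk-hits (T j))
    Tj≤m : toℕ (T j) ≤ toℕ m
    Tj≤m = subst (toℕ (T j) ≤_) (sym m-max) (≤-kbar (T j))
    pos-m<j : toℕ (pos m) < toℕ j
    pos-m<j = <lex-T⇒< (inj₂ (kbar-^ (suc r) (T j) ,
                subst₂ _<_ (sym (max⇒qk≡0 m (trans m-max (sym (kbar-^ (suc r) (T j)))))) (sym e) (s≤s z≤n)))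

  qk≡0⇒LRMax : ∀ j → qk σ (T j) ≡ 0 → IsLRMaxAt j
  qk≡0⇒LRMax j e i i<j = ≤-<-trans (≤-kbar (T i)) (subst (kbar σ (T i) <_) (sym (qk≡0⇒max (T j) e))
    (<lex-0⇒< (subst (λ q → Π σ (T i) <lex (kbar σ (T j) , q)) e (hat i j i<j))))

  σ-T-pred : ∀ {i j} → i ⋖ j → ¬ IsLRMaxAt j → σ ⟨$⟩ʳ T j ≡ T i
  σ-T-pred i⋖j ¬lr with adjacent i⋖j
  ... | sameCycle σTj≡Ti _ = σTj≡Ti
  ... | newCycle _ starts _ = contradiction (qk≡0⇒LRMax _ starts) ¬lr

  module _ {j} (lr : IsLRMaxAt j) where

    blockEnd : Fin n
    blockEnd = pos (σ ⟨$⟩ʳ T j)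

    T-blockEnd : T blockEnd ≡ σ ⟨$⟩ʳ T j
    T-blockEnd = inverseʳ τ

    kbar-blockEnd : kbar σ (T blockEnd) ≡ kbar σ (T j)
    kbar-blockEnd = trans (cong (kbar σ) T-blockEnd) (kbar-σ (T j))

    ≤-blockEnd : toℕ j ≤ toℕ blockEnd
    ≤-blockEnd with <-cmp (toℕ j) (toℕ blockEnd)
    ... | tri< lt _ _ = <⇒≤ lt
    ... | tri≈ _ eq _ = ≤-reflexive eq
    ... | tri> _ _ gt = contradiction kbar-blockEnd (<⇒≢ (<lex-0⇒<
          (subst (λ q → Π σ (T blockEnd) <lex (kbar σ (T j) , q)) (LRMax⇒qk≡0 j lr) (hat blockEnd j gt))))

    no-LRMax-in-block : ∀ k → toℕ j < toℕ k → toℕ k ≤ toℕ blockEnd → ¬ IsLRMaxAt k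
    no-LRMax-in-block k j<k k≤e lrₖ = <-irrefl refl (<-≤-trans Kj<Kk Kk≤Kj)
      where
      Kj<Kk : kbar σ (T j) < kbar σ (T k)
      Kj<Kk with hat j k j<k
      ... | inj₁ lt       = lt
      ... | inj₂ (_ , lt) = contradiction (subst₂ _<_ (LRMax⇒qk≡0 j lr) (LRMax⇒qk≡0 k lrₖ) lt) λ ()
      Kk≤Kj : kbar σ (T k) ≤ kbar σ (T j)
      Kk≤Kj with m≤n⇒m<n∨m≡n k≤e
      ... | inj₁ k<e = subst (kbar σ (T k) ≤_) kbar-blockEnd (<lex⇒≤ (hat k blockEnd k<e))
      ... | inj₂ k≡e = ≤-reflexive (trans (cong (kbar σ ∘ T) (toℕ-injective k≡e)) kbar-blockEnd)

    LRMax-after-block : ∀ {k} → blockEnd ⋖ k → IsLRMaxAt k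
    LRMax-after-block e⋖k with adjacent e⋖k
    ... | newCycle _ starts _ = qk≡0⇒LRMax _ starts
    ... | sameCycle σTk≡Te _  = contradiction (cong toℕ k≡j) (<⇒≢ j<k ∘ sym)
      where
      k≡j = ⟨$⟩ʳ-injective τ (⟨$⟩ʳ-injective σ (trans σTk≡Te T-blockEnd))
      j<k = ≤-<-trans ≤-blockEnd (⋖⇒< e⋖k)

module Ranking {n} (σ : Permutation′ n) where
  open Orbit σ

  below : Fin n → Subset n
  below x = tabulate λ y → does (Π σ y <lex? Π σ x)

  ∈-below⁺ : ∀ {x y} → Π σ y <lex Π σ x → y ∈ below x
  ∈-below⁺ {x} {y} lt = lookup⇒[]= y _ (trans (lookup∘tabulate _ y) (dec-true (Π σ y <lex? Π σ x) lt))

  ∈-below⁻ : ∀ {x y} → y ∈ below x → Π σ y <lex Π σ x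
  ∈-below⁻ {x} {y} y∈ with Π σ y <lex? Π σ x | trans (sym (lookup∘tabulate _ y)) ([]=⇒lookup y∈)
  ... | yes lt | _ = lt

  ∉-below-self : ∀ x → x ∉ below x
  ∉-below-self x = <lex-irrefl ∘ ∈-below⁻

  rank : Fin n → ℕ
  rank x = ∣ below x ∣

  rank-< : ∀ x → rank x < n
  rank-< x = subst (rank x <_) (∣⊤∣≡n n) (p⊂q⇒∣p∣<∣q∣ ((λ _ → ∈⊤) , x , ∈⊤ , ∉-below-self x))

  rank-mono : ∀ {x y} → Π σ x <lex Π σ y → rank x < rank y
  rank-mono {x} {y} lt =
    p⊂q⇒∣p∣<∣q∣ ((λ z∈ → ∈-below⁺ (<lex-trans (∈-below⁻ z∈) lt)) , x , ∈-below⁺ lt , ∉-below-self x)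

  rankᶠ : Fin n → Fin n
  rankᶠ x = fromℕ< (rank-< x)

  rankᶠ-injective : ∀ {x y} → rankᶠ x ≡ rankᶠ y → x ≡ y
  rankᶠ-injective {x} {y} e with <lex-compare (Π σ x) (Π σ y)
  ... | tri< lt _ _      = contradiction (fromℕ<-injective _ _ (rank-< x) (rank-< y) e) (<⇒≢ (rank-mono lt))
  ... | tri≈ _ (k , q) _ = Π-injective (cong₂ _,_ k q)
  ... | tri> _ _ gt      = contradiction (fromℕ<-injective _ _ (rank-< x) (rank-< y) e) (<⇒≢ (rank-mono gt) ∘ sym)

  rankPerm : Permutation′ n
  rankPerm = injective⇒permutation rankᶠ rankᶠ-injective

  sortByΠ : Permutation′ n
  sortByΠ = flip rankPerm

  rank-sortByΠ : ∀ i → rank (sortByΠ ⟨$⟩ʳ i) ≡ toℕ i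
  rank-sortByΠ i = trans (sym (toℕ-fromℕ< _)) (cong toℕ (inverseʳ rankPerm))

  sortByΠ-isHat : IsHat σ sortByΠ
  sortByΠ-isHat i j i<j with <lex-compare (Π σ (sortByΠ ⟨$⟩ʳ i)) (Π σ (sortByΠ ⟨$⟩ʳ j))
  ... | tri< lt _ _      = lt
  ... | tri≈ _ (k , q) _ = contradiction
    (trans (sym (rank-sortByΠ i)) (trans (cong rank (Π-injective (cong₂ _,_ k q))) (rank-sortByΠ j))) (<⇒≢ i<j)
  ... | tri> _ _ gt      = contradiction (subst₂ _<_ (rank-sortByΠ j) (rank-sortByΠ i) (rank-mono gt)) (<-asym i<j)

hat-unique : ∀ {n} (σ τ τ′ : Permutation′ n) → IsHat σ τ → IsHat σ τ′ → τ′ ≈ τ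
hat-unique {n} σ τ τ′ hat hat′ i = begin
  τ′ ⟨$⟩ʳ i     ≡⟨ inverseʳ τ ⟨
  τ ⟨$⟩ʳ ρ i    ≡⟨ cong (τ ⟨$⟩ʳ_) ρi≡i ⟩
  τ ⟨$⟩ʳ i      ∎
  where
  open ≡-Reasoning
  ρ ρ′ : Fin n → Fin n
  ρ k  = τ ⟨$⟩ˡ (τ′ ⟨$⟩ʳ k)
  ρ′ k = τ′ ⟨$⟩ˡ (τ ⟨$⟩ʳ k)
  ρ′ρi≡i : ρ′ (ρ i) ≡ i
  ρ′ρi≡i = trans (cong (τ′ ⟨$⟩ˡ_) (inverseʳ τ)) (inverseˡ τ′)
  i≤ρi : toℕ i ≤ toℕ (ρ i)
  i≤ρi = strictlyIncreasing⇒≤ ρ (λ a<b → Hat.pos-< σ τ hat (hat′ _ _ a<b)) i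
  ρi≤i : toℕ (ρ i) ≤ toℕ i
  ρi≤i = subst (λ k → toℕ (ρ i) ≤ toℕ k) ρ′ρi≡i
    (strictlyIncreasing⇒≤ ρ′ (λ a<b → Hat.pos-< σ τ′ hat′ (hat _ _ a<b)) (ρ i))
  ρi≡i : ρ i ≡ i
  ρi≡i = toℕ-injective (≤-antisym ρi≤i i≤ρi)

val-suc : ∀ {n} (τ : Permutation′ n) {k} (k<n : k < n) → val τ (suc k) ≡ toℕ (τ ⟨$⟩ʳ fromℕ< k<n)
val-suc {n} τ {k} k<n with k <? n
... | yes _   = refl
... | no  k≮n = contradiction k<n k≮n

val-suc-toℕ : ∀ {n} (τ : Permutation′ n) i → val τ (suc (toℕ i)) ≡ toℕ (τ ⟨$⟩ʳ i)
val-suc-toℕ τ i = trans (val-suc τ (toℕ<n i)) (cong (λ j → toℕ (τ ⟨$⟩ʳ j)) (fromℕ<-toℕ i (toℕ<n i)))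

-- positions are counted from 0 here, so the paper's even positions 2j are the odd k = 2j - 1
OddValleys : (ℕ → ℕ) → ℕ → Set
OddValleys t n = ∀ k → parity k ≡ 1ℙ → k < n → t k < t (pred k) × (suc k < n → t k < t (suc k))

module _ {n} (τ : Permutation′ n) where

  private
    AlternatesAt : ℕ → Set
    AlternatesAt K = val τ K < val τ (K ∸ 1) × val τ K < val τ (K + 1)

    ValleyAt : ℕ → Set
    ValleyAt k = val τ (suc k) < val τ k × val τ (suc k) < val τ (suc (suc k))

    alternatesAt⇒valleyAt : ∀ m → AlternatesAt (2 * suc m) → ValleyAt (suc (m + m))
    alternatesAt⇒valleyAt m alt =
      proj₁ alt′ , subst (λ x → val τ (suc (suc (m + m))) < val τ (suc (suc x))) (+-comm (m + m) 1) (proj₂ alt′)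
      where alt′ = subst AlternatesAt (2*suc m) alt

    valleyAt⇒alternatesAt : ∀ m → ValleyAt (suc (m + m)) → AlternatesAt (2 * suc m)
    valleyAt⇒alternatesAt m (descent , ascent) = subst AlternatesAt (sym (2*suc m))
      (descent , subst (λ x → val τ (suc (suc (m + m))) < val τ (suc (suc x))) (+-comm 1 (m + m)) ascent)

  OddValleys⇒IsAlternating : 1 ≤ n → OddValleys (val τ ∘ suc) n → IsAlternating τ
  OddValleys⇒IsAlternating 1≤n valleys = inner , last
    where
    inner : ∀ j → 2 ≤ 2 * j → 2 * j ≤ n ∸ 1 → AlternatesAt (2 * j)
    inner (suc m) _ 2j≤n-1 = valleyAt⇒alternatesAt m (descent , ascent k+1<n)
      where
      k+1<n : suc (suc (m + m)) < n
      k+1<n = subst (suc (suc (suc (m + m))) ≤_) (m+[n∸m]≡n 1≤n) (s≤s (subst (_≤ n ∸ 1) (2*suc m) 2j≤n-1))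
      valley = valleys (suc (m + m)) (parity-odd m) (<-trans (n<1+n _) k+1<n)
      descent = proj₁ valley
      ascent = proj₂ valley
    descent-at-odd : ∀ k → parity k ≡ 1ℙ → k < n → val τ (suc k) < val τ k
    descent-at-odd (suc k) odd k+1<n = proj₁ (valleys (suc k) odd k+1<n)
    last : Even n → val τ n < val τ (n ∸ 1)
    last ev = subst (λ N → val τ N < val τ (N ∸ 1)) n-1+1≡n (descent-at-odd (n ∸ 1) odd (subst (n ∸ 1 <_) n-1+1≡n ≤-refl))
      where
      n-1+1≡n = m+[n∸m]≡n 1≤n
      odd = ℙ.⁻¹-injective (trans (sym (parity-suc (n ∸ 1))) (trans (cong parity n-1+1≡n) (Even⇒parity≡0ℙ ev)))

  IsAlternating⇒OddValleys : Even n → IsAlternating τ → OddValleys (val τ ∘ suc) n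
  IsAlternating⇒OddValleys ev (inner , last) k odd k<n with m , refl ← parity≡1ℙ⇒odd k odd with m≤n⇒m<n∨m≡n k<n
  ... | inj₁ k+1<n = proj₁ valley , λ _ → proj₂ valley
    where
    2≤2j = subst (2 ≤_) (sym (2*suc m)) (s≤s (s≤s z≤n))
    2j≤n-1 = subst (_≤ n ∸ 1) (sym (2*suc m)) (∸-monoˡ-≤ 1 k+1<n)
    valley = alternatesAt⇒valleyAt m (inner (suc m) 2≤2j 2j≤n-1)
  ... | inj₂ refl = last ev , λ k+1<k+1 → contradiction k+1<k+1 (<-irrefl refl)

  adjacent⇒OddValleys :
    (∀ {i j} → i ⋖ j → parity (toℕ j) ≡ 1ℙ → toℕ (τ ⟨$⟩ʳ j) < toℕ (τ ⟨$⟩ʳ i)) →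
    (∀ {i j} → i ⋖ j → parity (toℕ i) ≡ 1ℙ → toℕ (τ ⟨$⟩ʳ i) < toℕ (τ ⟨$⟩ʳ j)) →
    OddValleys (val τ ∘ suc) n
  adjacent⇒OddValleys descent ascent (suc k) odd k+1<n = descent-k , ascent-k
    where
    val-at : ∀ i {k} → toℕ i ≡ k → val τ (suc k) ≡ toℕ (τ ⟨$⟩ʳ i)
    val-at i refl = val-suc-toℕ τ i
    j = fromℕ< k+1<n
    j≡k+1 = toℕ-fromℕ< k+1<n
    i = proj₁ (predecessor j j≡k+1)
    i⋖j = proj₁ (proj₂ (predecessor j j≡k+1))
    descent-k = subst₂ _<_ (sym (val-at j j≡k+1)) (sym (val-at i (proj₂ (proj₂ (predecessor j j≡k+1)))))
                  (descent i⋖j (subst (λ k → parity k ≡ 1ℙ) (sym j≡k+1) odd))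
    ascent-k : suc (suc k) < n → val τ (suc (suc k)) < val τ (suc (suc (suc k)))
    ascent-k k+2<n = subst₂ _<_ (sym (val-at j j≡k+1)) (sym (val-at l (toℕ-fromℕ< k+2<n)))
                       (ascent j⋖l (subst (λ k → parity k ≡ 1ℙ) (sym j≡k+1) odd))
      where
      l = fromℕ< k+2<n
      j⋖l = trans (toℕ-fromℕ< k+2<n) (cong suc (sym j≡k+1))

module Biexceeded {n} (σ : Permutation′ n) (bi : IsBiexceeded σ) where
  open Iterate σ
  open Orbit σ

  kind : Fin n → Parity
  kind x with bi x
  ... | inj₁ _ = 1ℙ
  ... | inj₂ _ = 0ℙ

  peak : ∀ x → kind x ≡ 0ℙ → toℕ (σ ⟨$⟩ʳ x) < toℕ x × toℕ (σ ⟨$⟩ˡ x) < toℕ x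
  peak x _ with bi x
  peak x () | inj₁ _
  ... | inj₂ p = p

  valley : ∀ x → kind x ≡ 1ℙ → toℕ x < toℕ (σ ⟨$⟩ʳ x) × toℕ x < toℕ (σ ⟨$⟩ˡ x)
  valley x _ with bi x
  valley x () | inj₂ _
  ... | inj₁ v = v

  kind-σ : ∀ x → kind (σ ⟨$⟩ʳ x) ≡ kind x ⁻¹
  kind-σ x with bi x | bi (σ ⟨$⟩ʳ x)
  ... | inj₁ _              | inj₂ _             = refl
  ... | inj₂ _              | inj₁ _             = refl
  ... | inj₁ (x<σx , _)     | inj₁ (_ , σx<x)    =
    contradiction (subst (λ y → toℕ (σ ⟨$⟩ʳ x) < toℕ y) (inverseˡ σ) σx<x) (<-asym x<σx)
  ... | inj₂ (σx<x , _)     | inj₂ (_ , x<σx)    =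
    contradiction (subst (λ y → toℕ y < toℕ (σ ⟨$⟩ʳ x)) (inverseˡ σ) x<σx) (<-asym σx<x)

  kind-^ : ∀ p x → kind (σ ^[ p ] x) ≡ parity p ℙ.+ kind x
  kind-^ zero    x = refl
  kind-^ (suc p) x = begin
    kind (σ ^[ suc p ] x)            ≡⟨ kind-σ (σ ^[ p ] x) ⟩
    kind (σ ^[ p ] x) ⁻¹             ≡⟨ cong _⁻¹ (kind-^ p x) ⟩
    1ℙ ℙ.+ (parity p ℙ.+ kind x)     ≡⟨ ℙ.+-assoc 1ℙ (parity p) (kind x) ⟨
    parity p ⁻¹ ℙ.+ kind x           ≡⟨ cong (ℙ._+ kind x) (parity-suc p) ⟨
    parity (suc p) ℙ.+ kind x        ∎
    where open ≡-Reasoning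

  cycle-even : ∀ p x → σ ^[ p ] x ≡ x → Even p
  cycle-even p x σᵖx≡x =
    parity≡0ℙ⇒Even p (ℙ.+-cancelʳ-≡ (kind x) (parity p) 0ℙ (trans (sym (kind-^ p x)) (cong kind σᵖx≡x)))

  cycle-end-odd : ∀ x → qk σ (σ ⟨$⟩ˡ x) ≡ 0 → parity (qk σ x) ≡ 1ℙ
  cycle-end-odd x closes = sym (ℙ.⁻¹-selfInverse (trans (sym (parity-suc (qk σ x)))
    (Even⇒parity≡0ℙ (cycle-even (suc (qk σ x)) (σ ⟨$⟩ˡ x) (cycle-closes x closes)))))

  max-peak : ∀ x → qk σ x ≡ 0 → kind x ≡ 0ℙ
  max-peak x _ with bi x
  ... | inj₂ _ = refl
  max-peak x q≡0 | inj₁ (x<σx , _) =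
    contradiction (subst (toℕ (σ ⟨$⟩ʳ x) ≤_) (sym (qk≡0⇒max x q≡0)) (kbar-upper x 1)) (<⇒≱ x<σx)

  kind≡parity-qk : ∀ x → kind x ≡ parity (qk σ x)
  kind≡parity-qk x = ℙ.+-cancelˡ-≡ (parity (qk σ x)) (kind x) (parity (qk σ x)) (begin
    parity (qk σ x) ℙ.+ kind x        ≡⟨ kind-^ (qk σ x) x ⟨
    kind (σ ^[ qk σ x ] x)            ≡⟨ max-peak _ (max⇒qk≡0 _ (trans (qk-hits x) (sym (kbar-^ (qk σ x) x)))) ⟩
    0ℙ                                ≡⟨ ℙ.p+p≡0ℙ (parity (qk σ x)) ⟨
    parity (qk σ x) ℙ.+ parity (qk σ x) ∎)
    where open ≡-Reasoning

  module _ (τ : Permutation′ n) (hat : IsHat σ τ) where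
    open Hat σ τ hat

    parity-qk-position : ∀ k i → toℕ i ≡ k → parity (qk σ (T i)) ≡ parity k
    parity-qk-position zero    i i≡0   = cong parity (first-qk≡0 i i≡0)
    parity-qk-position (suc k) j j≡k+1 with i , i⋖j , i≡k ← predecessor j j≡k+1 with adjacent i⋖j
    ... | sameCycle _ qk-suc = begin
      parity (qk σ (T j))          ≡⟨ cong parity qk-suc ⟩
      parity (suc (qk σ (T i)))    ≡⟨ parity-suc (qk σ (T i)) ⟩
      parity (qk σ (T i)) ⁻¹       ≡⟨ cong _⁻¹ (parity-qk-position k i i≡k) ⟩
      parity k ⁻¹                  ≡⟨ parity-suc k ⟨
      parity (suc k)               ∎
      where open ≡-Reasoning
    ... | newCycle closes starts _ = begin
      parity (qk σ (T j))          ≡⟨ cong parity starts ⟩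
      1ℙ ⁻¹                        ≡⟨ cong _⁻¹ (cycle-end-odd (T i) closes) ⟨
      parity (qk σ (T i)) ⁻¹       ≡⟨ cong _⁻¹ (parity-qk-position k i i≡k) ⟩
      parity k ⁻¹                  ≡⟨ parity-suc k ⟨
      parity (suc k)               ∎
      where open ≡-Reasoning

    kind-T : ∀ i → kind (T i) ≡ parity (toℕ i)
    kind-T i = trans (kind≡parity-qk (T i)) (parity-qk-position (toℕ i) i refl)

    descent-into-odd : ∀ {i j} → i ⋖ j → parity (toℕ j) ≡ 1ℙ → toℕ (T j) < toℕ (T i)
    descent-into-odd {i} {j} i⋖j odd with adjacent i⋖j
    ... | sameCycle σTj≡Ti _ = subst (λ x → toℕ (T j) < toℕ x) σTj≡Ti (proj₁ (valley (T j) (trans (kind-T j) odd)))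
    ... | newCycle _ starts _ = contradiction (trans (sym (trans (kind-T j) odd)) (trans (kind≡parity-qk (T j)) (cong parity starts))) λ ()

    ascent-from-odd : ∀ {i j} → i ⋖ j → parity (toℕ i) ≡ 1ℙ → toℕ (T i) < toℕ (T j)
    ascent-from-odd {i} {j} i⋖j odd with adjacent i⋖j
    ... | sameCycle σTj≡Ti _ = subst (λ x → toℕ x < toℕ (T j)) σTj≡Ti (proj₁ (peak (T j) Tj-peak))
      where
      Tj-peak : kind (T j) ≡ 0ℙ
      Tj-peak = trans (kind-T j) (trans (cong parity i⋖j) (trans (parity-suc (toℕ i)) (cong _⁻¹ odd)))
    ... | newCycle _ starts kbar-< = ≤-<-trans (≤-kbar (T i)) (subst (kbar σ (T i) <_) (sym (qk≡0⇒max (T j) starts)) kbar-<)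

    hat-OddValleys : OddValleys (val τ ∘ suc) n
    hat-OddValleys = adjacent⇒OddValleys τ descent-into-odd ascent-from-odd

    length-even : ∀ i → suc (toℕ i) ≡ n → Even n
    length-even i i+1≡n = parity≡0ℙ⇒Even n (begin
      parity n                     ≡⟨ cong parity i+1≡n ⟨
      parity (suc (toℕ i))         ≡⟨ parity-suc (toℕ i) ⟩
      parity (toℕ i) ⁻¹            ≡⟨ cong _⁻¹ (parity-qk-position (toℕ i) i refl) ⟨
      parity (qk σ (T i)) ⁻¹       ≡⟨ cong _⁻¹ (cycle-end-odd (T i) (last-closes i i+1≡n)) ⟩
      0ℙ                           ∎)
      where open ≡-Reasoning

module LRMaxima (t : ℕ → ℕ) where

  IsLRMax : ℕ → Set
  IsLRMax m = ∀ a → a < m → t a < t m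

  lastLRMax : ℕ → ℕ
  lastLRMax zero = zero
  lastLRMax (suc k) with t (lastLRMax k) <? t (suc k)
  ... | yes _ = suc k
  ... | no  _ = lastLRMax k

  lastLRMax-≤ : ∀ k → lastLRMax k ≤ k
  lastLRMax-≤ zero = z≤n
  lastLRMax-≤ (suc k) with t (lastLRMax k) <? t (suc k)
  ... | yes _ = ≤-refl
  ... | no  _ = m≤n⇒m≤1+n (lastLRMax-≤ k)

  ≤-lastLRMax : ∀ {j} k → j ≤ k → t j ≤ t (lastLRMax k)
  ≤-lastLRMax zero z≤n = ≤-refl
  ≤-lastLRMax {j} (suc k) j≤k+1 with t (lastLRMax k) <? t (suc k) | m≤n⇒m<n∨m≡n j≤k+1
  ... | yes _       | inj₂ refl  = ≤-refl
  ... | yes last<   | inj₁ j<k+1 = ≤-trans (≤-lastLRMax k (s≤s⁻¹ j<k+1)) (<⇒≤ last<)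
  ... | no  _       | inj₁ j<k+1 = ≤-lastLRMax k (s≤s⁻¹ j<k+1)
  ... | no  last≮   | inj₂ refl  = ≮⇒≥ last≮

  lastLRMax-isLRMax : ∀ k → IsLRMax (lastLRMax k)
  lastLRMax-isLRMax (suc k) a a<k+1 with t (lastLRMax k) <? t (suc k)
  ... | yes last< = ≤-<-trans (≤-lastLRMax k (s≤s⁻¹ a<k+1)) last<
  ... | no  _     = lastLRMax-isLRMax k a a<k+1

  no-LRMax-after-last : ∀ {k m} → lastLRMax k < m → m ≤ k → ¬ IsLRMax m
  no-LRMax-after-last {k} {m} last<m m≤k lr = <⇒≱ (lr (lastLRMax k) last<m) (≤-lastLRMax k m≤k)

  lastLRMax-self : ∀ {k} → IsLRMax k → lastLRMax k ≡ k
  lastLRMax-self {k} lr with m≤n⇒m<n∨m≡n (lastLRMax-≤ k)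
  ... | inj₁ last<k = contradiction lr (no-LRMax-after-last last<k ≤-refl)
  ... | inj₂ last≡k = last≡k

  lastLRMax-unique : ∀ {k s} → s ≤ k → IsLRMax s → (∀ m → s < m → m ≤ k → ¬ IsLRMax m) → lastLRMax k ≡ s
  lastLRMax-unique {k} {s} s≤k lr none with <-cmp (lastLRMax k) s
  ... | tri< last<s _ _ = contradiction lr (no-LRMax-after-last last<s s≤k)
  ... | tri≈ _ last≡s _ = last≡s
  ... | tri> _ _ s<last = contradiction (lastLRMax-isLRMax k) (none _ s<last (lastLRMax-≤ k))

  lastLRMax-mono : ∀ {j k} → j ≤ k → lastLRMax j ≤ lastLRMax k
  lastLRMax-mono {j} {k} j≤k = ≮⇒≥ λ lastk<lastj →
    no-LRMax-after-last lastk<lastj (≤-trans (lastLRMax-≤ j) j≤k) (lastLRMax-isLRMax j)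

  lastLRMax-suc : ∀ {m} → ¬ IsLRMax (suc m) → lastLRMax (suc m) ≡ lastLRMax m
  lastLRMax-suc {m} ¬lr with t (lastLRMax m) <? t (suc m)
  ... | yes last< = contradiction (λ a a<m+1 → ≤-<-trans (≤-lastLRMax m (s≤s⁻¹ a<m+1)) last<) ¬lr
  ... | no  _     = refl

  IsLRMax? : ∀ k → Dec (IsLRMax k)
  IsLRMax? k = map′ (λ last≡k → subst IsLRMax last≡k (lastLRMax-isLRMax k)) lastLRMax-self (lastLRMax k ≟ k)

module Reconstruction {n} (τ : Permutation′ n) where

  T : Fin n → Fin n
  T i = τ ⟨$⟩ʳ i

  -- t and nextPerm are opaque: otherwise a with-abstraction over a test such as k <? n
  -- also rewrites the copies of that test hidden inside val and next, and becomes ill-typed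
  opaque
    t : ℕ → ℕ
    t k = val τ (suc k)

    t-toℕ : ∀ i → t (toℕ i) ≡ toℕ (T i)
    t-toℕ = val-suc-toℕ τ

    t-injective : ∀ {a b} → a < n → b < n → t a ≡ t b → a ≡ b
    t-injective {a} {b} a<n b<n e = begin
      a                  ≡⟨ toℕ-fromℕ< a<n ⟨
      toℕ (fromℕ< a<n)   ≡⟨ cong toℕ (⟨$⟩ʳ-injective τ (toℕ-injective (trans (sym (val-suc τ a<n)) (trans e (val-suc τ b<n))))) ⟩
      toℕ (fromℕ< b<n)   ≡⟨ toℕ-fromℕ< b<n ⟩
      b                  ∎
      where open ≡-Reasoning

    OddValleys-t : OddValleys (val τ ∘ suc) n → OddValleys t n
    OddValleys-t valleys = valleys

  open LRMaxima t

  -- τ is cut into blocks starting at its left-to-right maxima, each read as a cycle of fromHat;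
  -- next k is the position of fromHat⁻¹ (τ k)
  data NextView (k : ℕ) : ℕ → Set where
    step : suc k < n → ¬ IsLRMax (suc k) → NextView k (suc k)
    wrap : (suc k < n → IsLRMax (suc k)) → NextView k (lastLRMax k)

  next : ℕ → ℕ
  next k with suc k <? n | IsLRMax? (suc k)
  ... | yes _ | no _ = suc k
  ... | _     | _    = lastLRMax k

  nextView : ∀ k → NextView k (next k)
  nextView k with suc k <? n | IsLRMax? (suc k)
  ... | yes k+1<n | no ¬lr = step k+1<n ¬lr
  ... | yes _     | yes lr = wrap λ _ → lr
  ... | no k+1≮n  | _      = wrap λ k+1<n → contradiction k+1<n k+1≮n

  next-< : ∀ {k} → k < n → next k < n
  next-< {k} k<n with next k | nextView k
  ... | _ | step k+1<n _ = k+1<n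
  ... | _ | wrap _       = ≤-<-trans (lastLRMax-≤ k) k<n

  next-suc : ∀ {k} → suc k < n → ¬ IsLRMax (suc k) → next k ≡ suc k
  next-suc {k} k+1<n ¬lr with next k | nextView k
  ... | _ | step _ _    = refl
  ... | _ | wrap wraps  = contradiction (wraps k+1<n) ¬lr

  next-LRMax : ∀ {k} → IsLRMax (next k) → (suc k < n → IsLRMax (suc k)) × next k ≡ lastLRMax k
  next-LRMax {k} lr with next k | nextView k
  ... | _ | step _ ¬lr  = contradiction lr ¬lr
  ... | _ | wrap wraps  = wraps , refl

  private
    wraps-distinct : ∀ {a b} → a < b → b < n → (suc a < n → IsLRMax (suc a)) → lastLRMax a ≢ lastLRMax b
    wraps-distinct {a} {b} a<b b<n a-wraps same = <⇒≱ (s≤s (lastLRMax-≤ a)) (begin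
      suc a                    ≡⟨ lastLRMax-self (a-wraps (<-≤-trans (s≤s a<b) b<n)) ⟨
      lastLRMax (suc a)        ≤⟨ lastLRMax-mono a<b ⟩
      lastLRMax b              ≡⟨ same ⟨
      lastLRMax a              ∎)
      where open ≤-Reasoning

  next-injective : ∀ {a b} → a < n → b < n → next a ≡ next b → a ≡ b
  next-injective {a} {b} a<n b<n e with next a | nextView a | next b | nextView b
  ... | _ | step _ _     | _ | step _ _     = suc-injective e
  ... | _ | step _ ¬lr   | _ | wrap _       = contradiction (subst IsLRMax (sym e) (lastLRMax-isLRMax b)) ¬lr
  ... | _ | wrap _       | _ | step _ ¬lr   = contradiction (subst IsLRMax e (lastLRMax-isLRMax a)) ¬lr
  ... | _ | wrap a-wraps | _ | wrap b-wraps with <-cmp a b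
  ...   | tri< a<b _ _ = contradiction e (wraps-distinct a<b b<n a-wraps)
  ...   | tri≈ _ a≡b _ = a≡b
  ...   | tri> _ _ b<a = contradiction (sym e) (wraps-distinct b<a a<n b-wraps)

  nextᶠ : Fin n → Fin n
  nextᶠ j = fromℕ< (next-< (toℕ<n j))

  toℕ-nextᶠ : ∀ j → toℕ (nextᶠ j) ≡ next (toℕ j)
  toℕ-nextᶠ j = toℕ-fromℕ< _

  nextᶠ-injective : ∀ {a b} → nextᶠ a ≡ nextᶠ b → a ≡ b
  nextᶠ-injective {a} {b} e = toℕ-injective (next-injective (toℕ<n a) (toℕ<n b)
    (trans (sym (toℕ-nextᶠ a)) (trans (cong toℕ e) (toℕ-nextᶠ b))))

  opaque
    nextPerm : Permutation′ n
    nextPerm = injective⇒permutation nextᶠ nextᶠ-injective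

    nextPerm-nextᶠ : ∀ j → nextPerm ⟨$⟩ʳ j ≡ nextᶠ j
    nextPerm-nextᶠ j = refl

  prev : Fin n → Fin n
  prev j = nextPerm ⟨$⟩ˡ j

  next-prev : ∀ j → nextᶠ (prev j) ≡ j
  next-prev j = trans (sym (nextPerm-nextᶠ (prev j))) (inverseʳ nextPerm)

  prev-next : ∀ j → prev (nextᶠ j) ≡ j
  prev-next j = trans (cong prev (sym (nextPerm-nextᶠ j))) (inverseˡ nextPerm)

  fromHat : Permutation′ n
  fromHat = flip τ ∘ₚ flip nextPerm ∘ₚ τ

  fromHat-T : ∀ k → fromHat ⟨$⟩ʳ T k ≡ T (prev k)
  fromHat-T k = cong (T ∘ prev) (inverseˡ τ)

  ¬LRMax⇒predecessor : ∀ j → ¬ IsLRMax (toℕ j) → ∃ λ (i : Fin n) → i ⋖ j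
  ¬LRMax⇒predecessor j ¬lr with toℕ j in j≡
  ... | zero  = contradiction (λ _ ()) ¬lr
  ... | suc k = let i , i⋖j , _ = predecessor j j≡ in i , trans (sym j≡) i⋖j

  next-prev-toℕ : ∀ j → next (toℕ (prev j)) ≡ toℕ j
  next-prev-toℕ j = trans (sym (toℕ-nextᶠ (prev j))) (cong toℕ (next-prev j))

  prev-¬LRMax : ∀ {i j} → i ⋖ j → ¬ IsLRMax (toℕ j) → prev j ≡ i
  prev-¬LRMax {i} {j} i⋖j ¬lr = trans (cong prev (sym next-i≡j)) (prev-next i)
    where
    next-i≡j : nextᶠ i ≡ j
    next-i≡j = toℕ-injective (trans (toℕ-nextᶠ i)
      (trans (next-suc (subst (_< n) i⋖j (toℕ<n j)) (subst (¬_ ∘ IsLRMax) i⋖j ¬lr)) (sym i⋖j)))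

  prev-LRMax : ∀ {j} → IsLRMax (toℕ j) →
               lastLRMax (toℕ (prev j)) ≡ toℕ j × (suc (toℕ (prev j)) < n → IsLRMax (suc (toℕ (prev j))))
  prev-LRMax {j} lr = let wraps , next≡last = next-LRMax (subst IsLRMax (sym (next-prev-toℕ j)) lr) in
    trans (sym next≡last) (next-prev-toℕ j) , wraps

  lastLRMax-prev : ∀ k → lastLRMax (toℕ (prev k)) ≡ lastLRMax (toℕ k)
  lastLRMax-prev k with IsLRMax? (toℕ k)
  ... | yes lr  = trans (proj₁ (prev-LRMax lr)) (sym (lastLRMax-self lr))
  ... | no  ¬lr with i , i⋖k ← ¬LRMax⇒predecessor k ¬lr = begin
    lastLRMax (toℕ (prev k))   ≡⟨ cong (lastLRMax ∘ toℕ) (prev-¬LRMax i⋖k ¬lr) ⟩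
    lastLRMax (toℕ i)          ≡⟨ lastLRMax-suc (subst (¬_ ∘ IsLRMax) i⋖k ¬lr) ⟨
    lastLRMax (suc (toℕ i))    ≡⟨ cong lastLRMax i⋖k ⟨
    lastLRMax (toℕ k)          ∎
    where open ≡-Reasoning

  iterate-in-block : ∀ p j → ∃ λ k → fromHat ^[ p ] (T j) ≡ T k × lastLRMax (toℕ k) ≡ lastLRMax (toℕ j)
  iterate-in-block zero    j = j , refl , refl
  iterate-in-block (suc p) j with k , e , same ← iterate-in-block p j =
    prev k , trans (cong (fromHat ⟨$⟩ʳ_) e) (fromHat-T k) , trans (lastLRMax-prev k) same

  walk-to-block-start : ∀ p j → p ≤ toℕ j ∸ lastLRMax (toℕ j) →
                        ∃ λ k → fromHat ^[ p ] (T j) ≡ T k × toℕ k ≡ toℕ j ∸ p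
  walk-to-block-start zero    j _  = j , refl , refl
  walk-to-block-start (suc p) j p<d with k , e , k≡j-p ← walk-to-block-start p j (<⇒≤ p<d) =
    i , trans (cong (fromHat ⟨$⟩ʳ_) e) (trans (fromHat-T k) (cong T (prev-¬LRMax i⋖k ¬lr))) , i≡j-p-1
    where
    s = lastLRMax (toℕ j)
    p<j = <-≤-trans p<d (m∸n≤m (toℕ j) s)
    s<k : s < toℕ k
    s<k = subst (s <_) (sym k≡j-p) (m<o∸n⇒n<o∸m (lastLRMax-≤ (toℕ j)) p<d)
    ¬lr : ¬ IsLRMax (toℕ k)
    ¬lr = no-LRMax-after-last s<k (subst (_≤ toℕ j) (sym k≡j-p) (m∸n≤m (toℕ j) p))
    i = proj₁ (¬LRMax⇒predecessor k ¬lr)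
    i⋖k = proj₂ (¬LRMax⇒predecessor k ¬lr)
    i≡j-p-1 : toℕ i ≡ toℕ j ∸ suc p
    i≡j-p-1 = suc-injective (trans (sym i⋖k) (trans k≡j-p (+-∸-assoc 1 p<j)))

  walk-to-start : ∀ j → fromHat ^[ toℕ j ∸ lastLRMax (toℕ j) ] (T j) ≡
                        T (fromℕ< (≤-<-trans (lastLRMax-≤ (toℕ j)) (toℕ<n j)))
  walk-to-start j with k , e , k≡ ← walk-to-block-start (toℕ j ∸ lastLRMax (toℕ j)) j ≤-refl =
    trans e (cong T (toℕ-injective (trans k≡ (trans (m∸[m∸n]≡n (lastLRMax-≤ (toℕ j))) (sym (toℕ-fromℕ< _))))))

  private module O = Orbit fromHat

  kbar-fromHat : ∀ j → kbar fromHat (T j) ≡ t (lastLRMax (toℕ j))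
  kbar-fromHat j = O.kbar-unique (T j) _ upper (toℕ j ∸ lastLRMax (toℕ j) , attained)
    where
    upper : ∀ p → toℕ (fromHat ^[ p ] (T j)) ≤ t (lastLRMax (toℕ j))
    upper p with k , e , same ← iterate-in-block p j =
      subst₂ _≤_ (trans (t-toℕ k) (cong toℕ (sym e))) (cong t same) (≤-lastLRMax (toℕ k) ≤-refl)
    attained : toℕ (fromHat ^[ toℕ j ∸ lastLRMax (toℕ j) ] (T j)) ≡ t (lastLRMax (toℕ j))
    attained = trans (cong toℕ (walk-to-start j)) (trans (sym (t-toℕ _)) (cong t (toℕ-fromℕ< _)))

  qk-fromHat : ∀ j → qk fromHat (T j) ≡ toℕ j ∸ lastLRMax (toℕ j)
  qk-fromHat j = O.qk-unique (T j) _ hits minimal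
    where
    s = lastLRMax (toℕ j)
    hits : toℕ (fromHat ^[ toℕ j ∸ s ] (T j)) ≡ kbar fromHat (T j)
    hits = trans (cong toℕ (walk-to-start j)) (trans (sym (t-toℕ _)) (trans (cong t (toℕ-fromℕ< _)) (sym (kbar-fromHat j))))
    minimal : ∀ p → p < toℕ j ∸ s → ¬ toℕ (fromHat ^[ p ] (T j)) ≡ kbar fromHat (T j)
    minimal p p<d hit with k , e , k≡j-p ← walk-to-block-start p j (<⇒≤ p<d) =
      <⇒≢ (subst (s <_) (sym k≡j-p) (m<o∸n⇒n<o∸m (lastLRMax-≤ (toℕ j)) p<d)) (sym k≡s)
      where
      k≡s : toℕ k ≡ s
      k≡s = t-injective (toℕ<n k) (≤-<-trans (lastLRMax-≤ (toℕ j)) (toℕ<n j))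
              (trans (t-toℕ k) (trans (cong toℕ (sym e)) (trans hit (kbar-fromHat j))))

  fromHat-isHat : IsHat fromHat τ
  fromHat-isHat i j i<j = subst₂ _<lex_ (sym (Π-fromHat i)) (sym (Π-fromHat j)) ordered
    where
    Π-fromHat : ∀ k → Π fromHat (T k) ≡ (t (lastLRMax (toℕ k)) , toℕ k ∸ lastLRMax (toℕ k))
    Π-fromHat k = cong₂ _,_ (kbar-fromHat k) (qk-fromHat k)
    sᵢ = lastLRMax (toℕ i)
    sⱼ = lastLRMax (toℕ j)
    ordered : (t sᵢ , toℕ i ∸ sᵢ) <lex (t sⱼ , toℕ j ∸ sⱼ)
    ordered with m≤n⇒m<n∨m≡n (lastLRMax-mono (<⇒≤ i<j))
    ... | inj₁ sᵢ<sⱼ = inj₁ (lastLRMax-isLRMax (toℕ j) sᵢ sᵢ<sⱼ)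
    ... | inj₂ sᵢ≡sⱼ = inj₂ (cong t sᵢ≡sⱼ ,
                         subst (λ s → toℕ i ∸ sᵢ < toℕ j ∸ s) sᵢ≡sⱼ (∸-monoˡ-< i<j (lastLRMax-≤ (toℕ i))))

  module _ (σ : Permutation′ n) (hat : IsHat σ τ) where
    open Hat σ τ hat using (IsLRMaxAt; σ-T-pred; blockEnd; T-blockEnd; ≤-blockEnd; no-LRMax-in-block; LRMax-after-block)

    IsLRMax⇒IsLRMaxAt : ∀ {j} → IsLRMax (toℕ j) → IsLRMaxAt j
    IsLRMax⇒IsLRMaxAt {j} lr i i<j = subst₂ _<_ (t-toℕ i) (t-toℕ j) (lr (toℕ i) i<j)

    IsLRMaxAt⇒IsLRMax : ∀ {j} → IsLRMaxAt j → IsLRMax (toℕ j)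
    IsLRMaxAt⇒IsLRMax {j} lr a a<j = subst₂ _<_ (trans (sym (t-toℕ i)) (cong t (toℕ-fromℕ< _))) (sym (t-toℕ j))
                                        (lr i (subst (_< toℕ j) (sym (toℕ-fromℕ< _)) a<j))
      where i = fromℕ< (<-trans a<j (toℕ<n j))

    prev-blockEnd : ∀ {j} (lr : IsLRMax (toℕ j)) → prev j ≡ blockEnd (IsLRMax⇒IsLRMaxAt lr)
    prev-blockEnd {j} lr = trans (cong prev (sym (toℕ-injective (trans (toℕ-nextᶠ e) next-e)))) (prev-next e)
      where
      lrᶠ = IsLRMax⇒IsLRMaxAt lr
      e = blockEnd lrᶠ
      none-inside : ∀ m → toℕ j < m → m ≤ toℕ e → ¬ IsLRMax m
      none-inside m j<m m≤e lrₘ = no-LRMax-in-block lrᶠ k (subst (toℕ j <_) (sym k≡m) j<m) (subst (_≤ toℕ e) (sym k≡m) m≤e)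
                                    (IsLRMax⇒IsLRMaxAt (subst IsLRMax (sym k≡m) lrₘ))
        where
        k = fromℕ< (≤-<-trans m≤e (toℕ<n e))
        k≡m = toℕ-fromℕ< (≤-<-trans m≤e (toℕ<n e))
      next-e : next (toℕ e) ≡ toℕ j
      next-e with next (toℕ e) | nextView (toℕ e)
      ... | _ | step e+1<n ¬lr = contradiction
              (subst IsLRMax (toℕ-fromℕ< e+1<n) (IsLRMaxAt⇒IsLRMax (LRMax-after-block lrᶠ (toℕ-fromℕ< e+1<n)))) ¬lr
      ... | _ | wrap _ = lastLRMax-unique (≤-blockEnd lrᶠ) lr none-inside

    σ-T : ∀ j → σ ⟨$⟩ʳ T j ≡ T (prev j)
    σ-T j with IsLRMax? (toℕ j)
    ... | yes lr  = trans (sym (T-blockEnd lrᶠ)) (cong T (sym (prev-blockEnd lr)))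
      where lrᶠ = IsLRMax⇒IsLRMaxAt lr
    ... | no  ¬lr with i , i⋖j ← ¬LRMax⇒predecessor j ¬lr =
      trans (σ-T-pred i⋖j (¬lr ∘ IsLRMaxAt⇒IsLRMax)) (cong T (sym (prev-¬LRMax i⋖j ¬lr)))

    hat-determines : σ ≈ fromHat
    hat-determines x = trans (cong (σ ⟨$⟩ʳ_) (sym (inverseʳ τ))) (σ-T (τ ⟨$⟩ˡ x))

  fromHat⁻¹-T : ∀ k → fromHat ⟨$⟩ˡ T k ≡ T (nextᶠ k)
  fromHat⁻¹-T k = cong T (trans (cong (nextPerm ⟨$⟩ʳ_) (inverseˡ τ)) (nextPerm-nextᶠ k))

  module _ (n-even : Even n) (valleys′ : OddValleys (val τ ∘ suc) n) where

    valleys : OddValleys t n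
    valleys = OddValleys-t valleys′

    odd-before-even : ∀ k → parity (suc k) ≡ 0ℙ → parity k ≡ 1ℙ
    odd-before-even k even = sym (ℙ.⁻¹-selfInverse (trans (sym (parity-suc k)) even))

    LRMax-even : ∀ {k} → k < n → IsLRMax k → parity k ≡ 0ℙ
    LRMax-even {zero}  _     _  = refl
    LRMax-even {suc k} k+1<n lr with parity (suc k) in p
    ... | 0ℙ = refl
    ... | 1ℙ = contradiction (lr k ≤-refl) (<-asym (proj₁ (valleys (suc k) p k+1<n)))

    blockEnd-odd : ∀ {k} → k < n → (suc k < n → IsLRMax (suc k)) → parity k ≡ 1ℙ
    blockEnd-odd {k} k<n wraps with m≤n⇒m<n∨m≡n k<n
    ... | inj₁ k+1<n = odd-before-even k (LRMax-even k+1<n (wraps k+1<n))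
    ... | inj₂ k+1≡n = odd-before-even k (trans (cong parity k+1≡n) (Even⇒parity≡0ℙ n-even))

    odd-¬LRMax : ∀ {k} → k < n → parity k ≡ 1ℙ → ¬ IsLRMax k
    odd-¬LRMax k<n odd lr = contradiction (trans (sym (LRMax-even k<n lr)) odd) λ ()

    next-below : ∀ {k} → k < n → parity k ≡ 0ℙ → t (next k) < t k
    next-below {k} k<n even with next k | nextView k
    ... | _ | step k+1<n _ = proj₁ (valleys (suc k) (trans (parity-suc k) (cong _⁻¹ even)) k+1<n)
    ... | _ | wrap wraps   = contradiction (trans (sym even) (blockEnd-odd k<n wraps)) λ ()

    next-above : ∀ {k} → k < n → parity k ≡ 1ℙ → t k < t (next k)
    next-above {k} k<n odd with next k | nextView k
    ... | _ | step k+1<n _ = proj₂ (valleys k odd k<n) k+1<n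
    ... | _ | wrap _       = ≤∧≢⇒< (≤-lastLRMax k ≤-refl) λ tk≡tlast →
      odd-¬LRMax k<n odd (subst IsLRMax (sym (t-injective k<n (≤-<-trans (lastLRMax-≤ k) k<n) tk≡tlast)) (lastLRMax-isLRMax k))

    prev-below : ∀ j → parity (toℕ j) ≡ 0ℙ → t (toℕ (prev j)) < t (toℕ j)
    prev-below j even with IsLRMax? (toℕ j)
    ... | yes lr = ≤∧≢⇒< (subst (λ s → t e ≤ t s) last≡j (≤-lastLRMax e ≤-refl)) λ te≡tj →
      contradiction (trans (sym e-odd) (trans (cong parity (t-injective (toℕ<n (prev j)) (toℕ<n j) te≡tj)) even)) λ ()
      where
      e = toℕ (prev j)
      last≡j = proj₁ (prev-LRMax lr)
      e-odd = blockEnd-odd (toℕ<n (prev j)) (proj₂ (prev-LRMax lr))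
    ... | no ¬lr with i , i⋖j ← ¬LRMax⇒predecessor j ¬lr =
      subst₂ (λ a b → t a < t b) (cong toℕ (sym (prev-¬LRMax i⋖j ¬lr))) (sym i⋖j)
        (proj₂ (valleys (toℕ i) (odd-before-even (toℕ i) (subst (λ k → parity k ≡ 0ℙ) i⋖j even)) (toℕ<n i))
          (subst (_< n) i⋖j (toℕ<n j)))

    prev-above : ∀ j → parity (toℕ j) ≡ 1ℙ → t (toℕ j) < t (toℕ (prev j))
    prev-above j odd with i , i⋖j ← ¬LRMax⇒predecessor j (odd-¬LRMax (toℕ<n j) odd) =
      subst (λ a → t (toℕ j) < t a) (trans (cong pred i⋖j) (cong toℕ (sym (prev-¬LRMax i⋖j (odd-¬LRMax (toℕ<n j) odd)))))
        (proj₁ (valleys (toℕ j) odd (toℕ<n j)))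

    fromHat-biexceeded : IsBiexceeded fromHat
    fromHat-biexceeded x = subst Exceeded (inverseʳ τ) (classify (τ ⟨$⟩ˡ x))
      where
      Exceeded : Fin n → Set
      Exceeded y = (toℕ y < toℕ (fromHat ⟨$⟩ʳ y) × toℕ y < toℕ (fromHat ⟨$⟩ˡ y))
                 ⊎ (toℕ (fromHat ⟨$⟩ʳ y) < toℕ y × toℕ (fromHat ⟨$⟩ˡ y) < toℕ y)
      σ-value : ∀ j → t (toℕ (prev j)) ≡ toℕ (fromHat ⟨$⟩ʳ T j)
      σ-value j = trans (t-toℕ (prev j)) (cong toℕ (sym (fromHat-T j)))
      σ⁻¹-value : ∀ j → t (next (toℕ j)) ≡ toℕ (fromHat ⟨$⟩ˡ T j)
      σ⁻¹-value j = trans (cong t (sym (toℕ-nextᶠ j))) (trans (t-toℕ (nextᶠ j)) (cong toℕ (sym (fromHat⁻¹-T j))))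
      classify : ∀ j → Exceeded (T j)
      classify j with parity (toℕ j) in p
      ... | 0ℙ = inj₂ ( subst₂ _<_ (σ-value j) (t-toℕ j) (prev-below j p)
                      , subst₂ _<_ (σ⁻¹-value j) (t-toℕ j) (next-below (toℕ<n j) p))
      ... | 1ℙ = inj₁ ( subst₂ _<_ (t-toℕ j) (σ-value j) (prev-above j p)
                      , subst₂ _<_ (t-toℕ j) (σ⁻¹-value j) (next-above (toℕ<n j) p))

open Ranking using (sortByΠ; sortByΠ-isHat)
open Reconstruction using (fromHat; fromHat-isHat; fromHat-biexceeded; hat-determines)

biexceeded⇒Even : ∀ {n} → 1 ≤ n → (σ : Permutation′ n) → IsBiexceeded σ → Even n
biexceeded⇒Even {suc m} _ σ bi =
  Biexceeded.length-even σ bi (sortByΠ σ) (sortByΠ-isHat σ) (fromℕ< ≤-refl) (cong suc (toℕ-fromℕ< ≤-refl))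

hat-alternating : ∀ {n} → 1 ≤ n → (σ τ : Permutation′ n) → IsBiexceeded σ → IsHat σ τ → IsAlternating τ
hat-alternating 1≤n σ τ bi hat = OddValleys⇒IsAlternating τ 1≤n (Biexceeded.hat-OddValleys σ bi τ hat)

hat-injective : ∀ {n} (σ σ′ τ : Permutation′ n) → IsHat σ τ → IsHat σ′ τ → σ ≈ σ′
hat-injective σ σ′ τ hat hat′ x = trans (hat-determines τ σ hat x) (sym (hat-determines τ σ′ hat′ x))

alternating⇒hat-of-biexceeded : ∀ {n} → Even n → (τ : Permutation′ n) → IsAlternating τ →
                                Σ (Permutation′ n) (λ σ → IsBiexceeded σ × IsHat σ τ)
alternating⇒hat-of-biexceeded n-even τ alt =
  fromHat τ , fromHat-biexceeded τ n-even (IsAlternating⇒OddValleys τ n-even alt) , fromHat-isHat τ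

proposition1p14 :
    ((n : ℕ) → 1 ≤ n → (σ : Permutation′ n) → IsBiexceeded σ →
       ∀ (k : Fin n) (p : ℕ) → IsCycleLength σ k p → Even p)
    × ((n : ℕ) → 1 ≤ n → ¬ Even n → (σ : Permutation′ n) → ¬ IsBiexceeded σ)
    × ((n : ℕ) → 1 ≤ n → Even n →
        -- σ̂ exists and is unique, for every permutation σ
        ((σ : Permutation′ n) → Σ (Permutation′ n) (λ τ → IsHat σ τ × ((τ′ : Permutation′ n) → IsHat σ τ′ → τ′ ≈ τ)))
        -- σ ∈ B_n implies σ̂ ∈ T_n
        × ((σ τ : Permutation′ n) → IsBiexceeded σ → IsHat σ τ → IsAlternating τ)
        -- injective on B_n
        × ((σ σ′ τ : Permutation′ n) → IsBiexceeded σ → IsBiexceeded σ′ → IsHat σ τ → IsHat σ′ τ → σ ≈ σ′)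
        -- surjective onto T_n
        × ((τ : Permutation′ n) → IsAlternating τ → Σ (Permutation′ n) (λ σ → IsBiexceeded σ × IsHat σ τ)))
proposition1p14 =
    (λ _ _ σ bi k p (_ , σᵖk≡k , _) → Biexceeded.cycle-even σ bi p k σᵖk≡k)
  , (λ _ 1≤n odd σ bi → odd (biexceeded⇒Even 1≤n σ bi))
  , λ _ 1≤n n-even →
        (λ σ → sortByΠ σ , sortByΠ-isHat σ , λ τ′ → hat-unique σ (sortByΠ σ) τ′ (sortByΠ-isHat σ))
      , hat-alternating 1≤n
      , (λ σ σ′ τ _ _ → hat-injective σ σ′ τ)
      , alternating⇒hat-of-biexceeded n-even
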